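{- For any odd integer $n\ge 3$, $\xi(C_n\square K_2)=n$.
   Context: All graphs are finite, simple, connected and undirected; $d_G(u,v)$ is the shortest-path distance. A set $D\subseteq V(G)$ is a distance-equalizer set of $G$ if for any two vertices $x,y\in V(G)\setminus D$ there is $w\in D$ with $d_G(x,w)=d_G(y,w)$. The equidistant dimension $\xi(G)$ is the minimum cardinality of a distance-equalizer set of $G$. $C_n$ is the cycle on $n$ vertices and $K_2$ the complete graph on two vertices. The Cartesian product $G\square H$ has vertex set $V(G)\times V(H)$, with $(g,h)\sim(g',h')$ iff either $g=g'$ and $hh'\in E(H)$, or $h=h'$ and $gg'\in E(G)$. -}

module Defs where

open import Data.Nat using (ℕ; zero; suc; _+_; _≤_; NonZero)
open import Data.Nat.DivMod using (_%_)
open import Data.Fin using (Fin; toℕ)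
open import Data.Bool using (Bool)
open import Data.Product using (_×_; _,_; ∃; Σ)
open import Data.Sum using (_⊎_)
open import Data.List using (List; length)
open import Data.List.Membership.Propositional using (_∈_; _∉_)
open import Data.List.Relation.Unary.Unique.Propositional using (Unique)
open import Relation.Binary.PropositionalEquality using (_≡_; _≢_)
open import Level using (0ℓ; suc) renaming (zero to lzero)

record Graph : Set₁ where
  field
    V   : Set
    Adj : V → V → Set
open Graph public

data Walk (G : Graph) : V G → V G → ℕ → Set where
  here : ∀ {x} → Walk G x x zero
  step : ∀ {x y z k} → Adj G x y → Walk G y z k → Walk G x z (ℕ.suc k)

Dist : (G : Graph) → V G → V G → ℕ → Set
Dist G x y k = Walk G x y k × (∀ m → Walk G x y m → k ≤ m)

IsDistanceEqualizer : (G : Graph) → List (V G) → Set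
IsDistanceEqualizer G D =
  ∀ x y → x ∉ D → y ∉ D →
    ∃ λ w → w ∈ D × ∃ λ k → Dist G x w k × Dist G y w k

EquidistantDimension : (G : Graph) → ℕ → Set
EquidistantDimension G r =
  (Σ (List (V G)) λ D → Unique D × IsDistanceEqualizer G D × length D ≡ r)
  × (∀ D → Unique D → IsDistanceEqualizer G D → r ≤ length D)

-- The cycle C_n on vertices 0..n-1 (i ~ i+1 mod n); simple for n ≥ 3.
Cycle : (n : ℕ) → .{{NonZero n}} → Graph
Cycle n = record
  { V = Fin n
  ; Adj = λ i j → (toℕ j ≡ (toℕ i + 1) % n) ⊎ (toℕ i ≡ (toℕ j + 1) % n)
  }

K2 : Graph
K2 = record { V = Bool ; Adj = λ a b → a ≢ b }

_□_ : Graph → Graph → Graph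
G □ H = record
  { V = V G × V H
  ; Adj = λ { (g , h) (g' , h') →
      (g ≡ g' × Adj H h h') ⊎ (h ≡ h' × Adj G g g') }
  }

-- Upper bound: for odd n the layer C_n × {false} is distance-equalizing. The vertices
-- (i, true) and (j, true) are exchanged by the reflection x ↦ i + j − x of C_n, and since
-- 2 is invertible modulo n this reflection fixes a vertex m; hence both are at the same
-- distance from (m, false).
-- Lower bound: (g, false) and (g, true) are never equidistant from a vertex w, because
-- projecting a walk that starts in the other layer into the layer of w removes at least
-- the edge crossing between layers. So a distance-equalizer set meets every fibre
-- {g} × K_2 and has at least n elements.
module Submission where

open import Defs
open import Data.Nat using (ℕ; zero; suc; _+_; _*_; _∸_; _≤_; _<_; z≤n; s≤s; NonZero)
import Data.Nat as ℕ
open import Data.Nat.Properties hiding (_≟_)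
open import Data.Nat.DivMod
open import Data.Nat.Induction using (<-wellFounded)
open import Data.Nat.Tactic.RingSolver using (solve-∀)
open import Data.Fin using (Fin; toℕ; fromℕ<)
import Data.Fin.Properties as Fin
open import Data.Bool using (true; false)
import Data.Bool.Properties as Bool
open import Data.Product using (_×_; _,_; ∃; proj₁; proj₂; map₁)
open import Data.Product.Properties using (≡-dec)
open import Data.Sum using (inj₁; inj₂)
open import Data.List using (List; []; _∷_; length; map; lookup; allFin; cartesianProduct)
open import Data.List.Properties using (length-map; length-tabulate)
open import Data.List.Membership.Propositional using (_∈_; lose)
open import Data.List.Membership.Propositional.Properties
  using (∈-map⁺; ∈-allFin; ∈-cartesianProduct⁺)
import Data.List.Membership.DecPropositional as DecMembership
open import Data.List.Relation.Unary.Any using (here; there; any?; satisfied; index)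
open import Data.List.Relation.Unary.Any.Properties using (lookup-index)
open import Data.List.Relation.Unary.Unique.Propositional using (Unique)
open import Data.List.Relation.Unary.Unique.Propositional.Properties using (map⁺; allFin⁺)
open import Data.Empty using (⊥-elim)
open import Induction.WellFounded using (Acc; acc)
open import Relation.Nullary using (Dec; yes; no; ¬_)
open import Relation.Nullary.Decidable using (_×-dec_; _⊎-dec_; ¬?)
open import Relation.Binary.Definitions using (DecidableEquality)
open import Relation.Binary.PropositionalEquality

least-witness : ∀ {P : ℕ → Set} → (∀ m → Dec (P m)) →
  ∀ {n} → P n → ∃ λ m → P m × (∀ j → P j → m ≤ j)
least-witness {P} P? = go (<-wellFounded _)
  where
  go : ∀ {n} → Acc _<_ n → P n → ∃ λ m → P m × (∀ j → P j → m ≤ j)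
  go {n} (acc smaller) pn with anyUpTo? P? n
  ... | yes (m , m<n , pm) = go (smaller m<n) pm
  ... | no none            = n , pn , λ j pj → ≮⇒≥ λ j<n → none (j , j<n , pj)

covering⇒n≤length : ∀ {n} (xs : List (Fin n)) → (∀ i → i ∈ xs) → n ≤ length xs
covering⇒n≤length {n} xs covers with n ≤? length xs
... | yes n≤len = n≤len
... | no n≰len with Fin.pigeonhole (≰⇒> n≰len) (λ i → index (covers i))
... | i , j , i<j , same-index = ⊥-elim (Fin.<⇒≢ i<j (begin
  i                             ≡⟨ lookup-index (covers i) ⟩
  lookup xs (index (covers i))  ≡⟨ cong (lookup xs) same-index ⟩
  lookup xs (index (covers j))  ≡⟨ lookup-index (covers j) ⟨
  j                             ∎))
  where open ≡-Reasoning

module Modular (n : ℕ) .{{_ : NonZero n}} where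

  infix 4 _≈_
  _≈_ : ℕ → ℕ → Set
  a ≈ b = a % n ≡ b % n

  %-≈ : ∀ a → a % n ≈ a
  %-≈ a = m%n%n≡m%n a n

  +-cong : ∀ {a b c d} → a ≈ b → c ≈ d → a + c ≈ b + d
  +-cong {a} {b} {c} {d} a≈b c≈d = begin
    (a + c) % n           ≡⟨ %-distribˡ-+ a c n ⟩
    (a % n + c % n) % n   ≡⟨ cong₂ (λ x y → (x + y) % n) a≈b c≈d ⟩
    (b % n + d % n) % n   ≡⟨ %-distribˡ-+ b d n ⟨
    (b + d) % n           ∎
    where open ≡-Reasoning

  *-congˡ : ∀ c {a b} → a ≈ b → c * a ≈ c * b
  *-congˡ c {a} {b} a≈b = begin
    (c * a) % n             ≡⟨ %-distribˡ-* c a n ⟩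
    (c % n * (a % n)) % n   ≡⟨ cong (λ x → (c % n * x) % n) a≈b ⟩
    (c % n * (b % n)) % n   ≡⟨ %-distribˡ-* c b n ⟨
    (c * b) % n             ∎
    where open ≡-Reasoning

  +-inverseˡ : ∀ a → (n ∸ 1) * a + a ≈ 0
  +-inverseˡ a = begin
    ((n ∸ 1) * a + a) % n   ≡⟨ cong (_% n) (+-comm ((n ∸ 1) * a) a) ⟩
    (suc (n ∸ 1) * a) % n   ≡⟨ cong (λ m → (m * a) % n) (suc-pred n) ⟩
    (n * a) % n             ≡⟨ cong (_% n) (*-comm n a) ⟩
    (a * n) % n             ≡⟨ m*n%n≡0 a n ⟩
    0                       ≡⟨ m*n%n≡0 0 n ⟨
    0 % n                   ∎
    where open ≡-Reasoning

  +-cancelˡ : ∀ a {b c} → a + b ≈ a + c → b ≈ c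
  +-cancelˡ a {b} {c} ab≈ac = begin
    b % n                        ≡⟨ +-cong {0} (sym (+-inverseˡ a)) refl ⟩
    ((n ∸ 1) * a + a + b) % n    ≡⟨ cong (_% n) (+-assoc ((n ∸ 1) * a) a b) ⟩
    ((n ∸ 1) * a + (a + b)) % n  ≡⟨ +-cong {(n ∸ 1) * a} refl ab≈ac ⟩
    ((n ∸ 1) * a + (a + c)) % n  ≡⟨ cong (_% n) (+-assoc ((n ∸ 1) * a) a c) ⟨
    ((n ∸ 1) * a + a + c) % n    ≡⟨ +-cong {_} {0} (+-inverseˡ a) refl ⟩
    c % n                        ∎
    where open ≡-Reasoning

  toℕ-% : ∀ (i : Fin n) → toℕ i % n ≡ toℕ i
  toℕ-% i = m<n⇒m%n≡m (Fin.toℕ<n i)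

  toℕ-≈-injective : ∀ {i j : Fin n} → toℕ i ≈ toℕ j → i ≡ j
  toℕ-≈-injective {i} {j} i≈j = Fin.toℕ-injective (trans (sym (toℕ-% i)) (trans i≈j (toℕ-% j)))

  residue : ℕ → Fin n
  residue a = fromℕ< (m%n<n a n)

  toℕ-residue : ∀ a → toℕ (residue a) ≈ a
  toℕ-residue a = trans (cong (_% n) (Fin.toℕ-fromℕ< (m%n<n a n))) (%-≈ a)

Homomorphism : (G H : Graph) → (V G → V H) → Set
Homomorphism G H f = ∀ {x y} → Adj G x y → Adj H (f x) (f y)

map-walk : ∀ {G H f} → Homomorphism G H f → ∀ {x y L} → Walk G x y L → Walk H (f x) (f y) L
map-walk hom here           = here
map-walk hom (step adj walk) = step (hom adj) (map-walk hom walk)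

dist-involution : ∀ {G f} → Homomorphism G G f → (∀ x → f (f x) ≡ x) →
  ∀ {x y k} → Dist G x y k → Dist G (f x) (f y) k
dist-involution {G} {f} hom involutive {x} {y} (walk , shortest) =
  map-walk hom walk , λ m walk′ →
    shortest m (subst₂ (λ a b → Walk G a b m) (involutive x) (involutive y) (map-walk hom walk′))

map₁-homomorphism : ∀ {G G′ H f} → Homomorphism G G′ f → Homomorphism (G □ H) (G′ □ H) (map₁ f)
map₁-homomorphism hom (inj₁ (refl , adj)) = inj₁ (refl , adj)
map₁-homomorphism hom (inj₂ (refl , adj)) = inj₂ (refl , hom adj)

layer-homomorphism : ∀ {G H} (h : V H) → Homomorphism G (G □ H) (_, h)
layer-homomorphism h adj = inj₂ (refl , adj)

project-walk : ∀ {G H g g′ h h′ L} → Walk (G □ H) (g , h) (g′ , h′) L →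
  ∃ λ L′ → Walk G g g′ L′ × L′ ≤ L × (h ≢ h′ → L′ < L)
project-walk here = 0 , here , z≤n , λ h≢h → ⊥-elim (h≢h refl)
project-walk (step (inj₁ (refl , _)) walk) with project-walk walk
... | L′ , walk′ , L′≤L , _ = L′ , walk′ , m≤n⇒m≤1+n L′≤L , λ _ → s≤s L′≤L
project-walk (step (inj₂ (refl , adj)) walk) with project-walk walk
... | L′ , walk′ , L′≤L , strict = suc L′ , step adj walk′ , s≤s L′≤L , λ h≢h′ → s≤s (strict h≢h′)

other-layer-farther : ∀ {G H g g′ h h′ k L} → h ≢ h′ →
  Dist (G □ H) (g , h′) (g′ , h′) k → Walk (G □ H) (g , h) (g′ , h′) L → k < L
other-layer-farther {G} {H} {h′ = h′} h≢h′ (_ , shortest) walk with project-walk walk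
... | L′ , walk′ , _ , strict =
  ≤-<-trans (shortest L′ (map-walk {G} {G □ H} (layer-homomorphism {G} {H} h′) walk′)) (strict h≢h′)

fibre-not-equidistant : ∀ {G g w k} → Dist (G □ K2) (g , false) w k → ¬ Dist (G □ K2) (g , true) w k
fibre-not-equidistant {w = _ , false} dist-false (walk-true , _) =
  <-irrefl refl (other-layer-farther (λ ()) dist-false walk-true)
fibre-not-equidistant {w = _ , true} (walk-false , _) dist-true =
  <-irrefl refl (other-layer-farther (λ ()) dist-true walk-false)

equalizer-meets-fibres : ∀ {G} → DecidableEquality (V G) → ∀ {D} → IsDistanceEqualizer (G □ K2) D →
  ∀ g → g ∈ map proj₁ D
equalizer-meets-fibres _≟_ {D} equalizer g
  with (g , false) ∈? D | (g , true) ∈? D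
  where open DecMembership (≡-dec _≟_ Bool._≟_)
... | yes g-false∈D | _          = ∈-map⁺ proj₁ g-false∈D
... | no _          | yes g-true∈D = ∈-map⁺ proj₁ g-true∈D
... | no g-false∉D  | no g-true∉D
  with _ , _ , _ , dist-false , dist-true ← equalizer (g , false) (g , true) g-false∉D g-true∉D
  = ⊥-elim (fibre-not-equidistant dist-false dist-true)

record Finite (G : Graph) : Set where
  field
    _≟_          : DecidableEquality (V G)
    adj?         : ∀ x y → Dec (Adj G x y)
    vertices     : List (V G)
    ∈-vertices   : ∀ x → x ∈ vertices

  walk? : ∀ L x y → Dec (Walk G x y L)
  walk? zero x y with x ≟ y
  ... | yes refl = yes here
  ... | no x≢y   = no λ { here → x≢y refl }
  walk? (suc L) x y with any? (λ z → adj? x z ×-dec walk? L z y) vertices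
  ... | yes first-steps with z , adj , walk ← satisfied first-steps = yes (step adj walk)
  ... | no none = no λ { (step {y = z} adj walk) → none (lose (∈-vertices z) (adj , walk)) }

  walk⇒dist : ∀ {x y L} → Walk G x y L → ∃ (Dist G x y)
  walk⇒dist {x} {y} = least-witness (λ L → walk? L x y)

open Finite using (walk⇒dist)

□-finite : ∀ {G H} → Finite G → Finite H → Finite (G □ H)
□-finite {G} {H} finG finH = record
  { _≟_        = ≡-dec G._≟_ H._≟_
  ; adj?       = λ { (g , h) (g′ , h′) →
                   (g G.≟ g′ ×-dec H.adj? h h′) ⊎-dec (h H.≟ h′ ×-dec G.adj? g g′) }
  ; vertices   = cartesianProduct G.vertices H.vertices
  ; ∈-vertices = λ { (g , h) → ∈-cartesianProduct⁺ (G.∈-vertices g) (H.∈-vertices h) }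
  }
  where
  module G = Finite finG
  module H = Finite finH

K2-finite : Finite K2
K2-finite = record
  { _≟_        = Bool._≟_
  ; adj?       = λ a b → ¬? (a Bool.≟ b)
  ; vertices   = true ∷ false ∷ []
  ; ∈-vertices = λ { true → here refl ; false → there (here refl) }
  }

module CycleProperties (n : ℕ) .{{_ : NonZero n}} where
  open Modular n

  cycle-finite : Finite (Cycle n)
  cycle-finite = record
    { _≟_        = Fin._≟_
    ; adj?       = λ a b → (toℕ b ℕ.≟ (toℕ a + 1) % n) ⊎-dec (toℕ a ℕ.≟ (toℕ b + 1) % n)
    ; vertices   = allFin n
    ; ∈-vertices = ∈-allFin
    }

  walk-forward : ∀ d (a b : Fin n) → toℕ b ≈ toℕ a + d → Walk (Cycle n) a b d
  walk-forward zero a b b≈a+0 = subst (λ c → Walk (Cycle n) a c 0)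
    (toℕ-≈-injective (trans (cong (_% n) (sym (+-identityʳ (toℕ a)))) (sym b≈a+0))) here
  walk-forward (suc d) a b b≈a+1+d =
    step (inj₁ (Fin.toℕ-fromℕ< _)) (walk-forward d (residue (toℕ a + 1)) b (begin
      toℕ b % n                            ≡⟨ b≈a+1+d ⟩
      (toℕ a + suc d) % n                  ≡⟨ cong (_% n) (sym (+-assoc (toℕ a) 1 d)) ⟩
      (toℕ a + 1 + d) % n                  ≡⟨ +-cong (sym (toℕ-residue (toℕ a + 1))) refl ⟩
      (toℕ (residue (toℕ a + 1)) + d) % n  ∎))
    where open ≡-Reasoning

  connected : ∀ (a b : Fin n) → ∃ (Walk (Cycle n) a b)
  connected a b = _ , walk-forward ((n ∸ 1) * toℕ a + toℕ b) a b (begin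
    toℕ b % n                                ≡⟨ +-cong {0} (sym (+-inverseˡ (toℕ a))) refl ⟩
    ((n ∸ 1) * toℕ a + toℕ a + toℕ b) % n    ≡⟨ cong (_% n) (rearrange ((n ∸ 1) * toℕ a) (toℕ a) (toℕ b)) ⟩
    (toℕ a + ((n ∸ 1) * toℕ a + toℕ b)) % n  ∎)
    where
    open ≡-Reasoning
    rearrange : ∀ x y z → x + y + z ≡ y + (x + z)
    rearrange = solve-∀

  -- y is the image of x under the reflection x ↦ c − x of ℤ/n.
  Mirror : ℕ → Fin n → Fin n → Set
  Mirror c x y = toℕ x + toℕ y ≈ c

  mirror-sym : ∀ {c x y} → Mirror c x y → Mirror c y x
  mirror-sym {x = x} {y} = trans (cong (_% n) (+-comm (toℕ y) (toℕ x)))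

  mirror-unique : ∀ {c x y z} → Mirror c x y → Mirror c x z → y ≡ z
  mirror-unique {x = x} {y} {z} y-mirror z-mirror =
    toℕ-≈-injective (+-cancelˡ (toℕ x) (trans y-mirror (sym z-mirror)))

  reflect : ℕ → Fin n → Fin n
  reflect c x = residue (c + (n ∸ 1) * toℕ x)

  mirror-reflect : ∀ c x → Mirror c x (reflect c x)
  mirror-reflect c x = begin
    (toℕ x + toℕ (reflect c x)) % n          ≡⟨ +-cong {toℕ x} refl (toℕ-residue (c + (n ∸ 1) * toℕ x)) ⟩
    (toℕ x + (c + (n ∸ 1) * toℕ x)) % n      ≡⟨ cong (_% n) (rearrange (toℕ x) c ((n ∸ 1) * toℕ x)) ⟩
    (c + ((n ∸ 1) * toℕ x + toℕ x)) % n      ≡⟨ +-cong {c} refl (+-inverseˡ (toℕ x)) ⟩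
    (c + 0) % n                              ≡⟨ cong (_% n) (+-identityʳ c) ⟩
    c % n                                    ∎
    where
    open ≡-Reasoning
    rearrange : ∀ x c y → x + (c + y) ≡ c + (y + x)
    rearrange = solve-∀

  reflect-involutive : ∀ c x → reflect c (reflect c x) ≡ x
  reflect-involutive c x =
    mirror-unique (mirror-reflect c (reflect c x)) (mirror-sym {c} {x} (mirror-reflect c x))

  reflect-successor : ∀ c {a b : Fin n} → toℕ b ≈ toℕ a + 1 →
    toℕ (reflect c a) ≈ toℕ (reflect c b) + 1
  reflect-successor c {a} {b} b≈a+1 = +-cancelˡ (toℕ a) (begin
    (toℕ a + a′) % n        ≡⟨ mirror-reflect c a ⟩
    c % n                   ≡⟨ mirror-reflect c b ⟨
    (toℕ b + b′) % n        ≡⟨ +-cong b≈a+1 refl ⟩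
    (toℕ a + 1 + b′) % n    ≡⟨ cong (_% n) (rearrange (toℕ a) b′) ⟩
    (toℕ a + (b′ + 1)) % n  ∎)
    where
    open ≡-Reasoning
    a′ = toℕ (reflect c a)
    b′ = toℕ (reflect c b)
    rearrange : ∀ a b → a + 1 + b ≡ a + (b + 1)
    rearrange = solve-∀

  reflect-homomorphism : ∀ c → Homomorphism (Cycle n) (Cycle n) (reflect c)
  reflect-homomorphism c {a} {b} (inj₁ b≡a+1) =
    inj₂ (trans (sym (toℕ-% _)) (reflect-successor c (trans (toℕ-% b) b≡a+1)))
  reflect-homomorphism c {a} {b} (inj₂ a≡b+1) =
    inj₁ (trans (sym (toℕ-% _)) (reflect-successor c (trans (toℕ-% a) a≡b+1)))

  midpoint : ∀ {half} → half + half ≈ 1 → ∀ c → ∃ λ m → Mirror c m m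
  midpoint {half} half-inverse c = m , (begin
    (toℕ m + toℕ m) % n           ≡⟨ +-cong {toℕ m} {c * half} {toℕ m} {c * half} (toℕ-residue _) (toℕ-residue _) ⟩
    (c * half + c * half) % n     ≡⟨ cong (_% n) (*-distribˡ-+ c half half) ⟨
    (c * (half + half)) % n       ≡⟨ *-congˡ c half-inverse ⟩
    (c * 1) % n                   ≡⟨ cong (_% n) (*-identityʳ c) ⟩
    c % n                         ∎)
    where
    open ≡-Reasoning
    m = residue (c * half)

module Prism (n : ℕ) .{{_ : NonZero n}} where
  open Modular n
  open CycleProperties n

  bottom-layer : List (V (Cycle n □ K2))
  bottom-layer = map (_, false) (allFin n)

  ∈-bottom-layer : ∀ i → (i , false) ∈ bottom-layer
  ∈-bottom-layer i = ∈-map⁺ (_, false) (∈-allFin i)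

  bottom-layer-unique : Unique bottom-layer
  bottom-layer-unique = map⁺ (cong proj₁) (allFin⁺ n)

  length-bottom-layer : length bottom-layer ≡ n
  length-bottom-layer = trans (length-map _ (allFin n)) (length-tabulate (λ i → i))

  reflect-dist : ∀ c {x y k} → Dist (Cycle n □ K2) x y k →
    Dist (Cycle n □ K2) (map₁ (reflect c) x) (map₁ (reflect c) y) k
  reflect-dist c = dist-involution {Cycle n □ K2}
    (map₁-homomorphism {Cycle n} {Cycle n} {K2} (reflect-homomorphism c))
    (λ (x , b) → cong (_, b) (reflect-involutive c x))

  dist-to-bottom : ∀ i m → ∃ (Dist (Cycle n □ K2) (i , true) (m , false))
  dist-to-bottom i m = walk⇒dist (□-finite cycle-finite K2-finite)
    (step (inj₁ (refl , λ ()))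
          (map-walk {Cycle n} {Cycle n □ K2} (layer-homomorphism {Cycle n} {K2} false) (proj₂ (connected i m))))

  bottom-layer-equalizer : ∀ {half} → half + half ≈ 1 → IsDistanceEqualizer (Cycle n □ K2) bottom-layer
  bottom-layer-equalizer _ (i , false) _ i∉ _ = ⊥-elim (i∉ (∈-bottom-layer i))
  bottom-layer-equalizer _ (_ , true) (j , false) _ j∉ = ⊥-elim (j∉ (∈-bottom-layer j))
  bottom-layer-equalizer {half} half-inverse (i , true) (j , true) _ _
    with m , m-fixed ← midpoint {half} half-inverse (toℕ i + toℕ j)
    with d , dist-i ← dist-to-bottom i m
    = (m , false) , ∈-bottom-layer m , d , dist-i ,
      subst₂ (λ x y → Dist (Cycle n □ K2) (x , true) (y , false) d) i↦j m↦m (reflect-dist c dist-i)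
    where
    c = toℕ i + toℕ j
    i↦j : reflect c i ≡ j
    i↦j = mirror-unique {z = j} (mirror-reflect c i) refl
    m↦m : reflect c m ≡ m
    m↦m = mirror-unique (mirror-reflect c m) m-fixed

  equalizer-length : ∀ D → IsDistanceEqualizer (Cycle n □ K2) D → n ≤ length D
  equalizer-length D equalizer = subst (n ≤_) (length-map proj₁ D)
    (covering⇒n≤length (map proj₁ D) (equalizer-meets-fibres Fin._≟_ equalizer))

mainTheorem9 : (k : ℕ) → 1 ≤ k →
    EquidistantDimension (Cycle (suc (2 * k)) □ K2) (suc (2 * k))
mainTheorem9 k _ =
    (bottom-layer , bottom-layer-unique , bottom-layer-equalizer {suc k} half-inverse , length-bottom-layer)
  , λ D _ → equalizer-length D
  where
  open Modular (suc (2 * k))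
  open Prism (suc (2 * k))
  half-inverse : suc k + suc k ≈ 1
  half-inverse = trans (cong (_% suc (2 * k)) (double k)) ([m+n]%n≡m%n 1 (suc (2 * k)))
    where
    double : ∀ k → suc k + suc k ≡ 1 + suc (2 * k)
    double = solve-∀
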